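{- $PRA$ and $WPRA$ are equivalent over $COMI_{fcn}$: $COMI_{fcn}+PRA$ proves $WPRA$ and $COMI_{fcn}+WPRA$ proves $PRA$.
   Context: The language $L_{fcn}$ is four-sorted: number variables ranging over $\omega$; function variables of arity 1, 2, 3 ranging over unary, binary, ternary functions on $\omega$; a constant $0$ and unary function symbol $S$ (successor). Terms are number variables, $0$, $S(t)$, and $f(t)$, $f(t,q)$, $f(t,q,r)$ for function variables of the corresponding arity; atomic formulas are equations of terms; formulas use connectives and quantifiers over numbers and functions of each arity. Free variables in axioms are read universally. $COMI_{fcn}$ consists of: (1) Successor axioms: $S(n)\neq 0$; $S(n)=S(m)\rightarrow n=m$; $n\neq 0\rightarrow(\exists m)(S(m)=n)$. (2) Initial function axioms: $(\exists f)(\forall m)(f(m)=n)$ ($f$ unary); ternary projections $(\exists f)(\forall m,n,r)(f(m,n,r)=m)$, and likewise with $=n$, $=r$; $(\exists f)(\forall n)(f(n)=S(n))$. (3) Composition axioms: (i) $(\exists f)(\forall m,n,r)(f(m,n,r)=g(m,n))$; (ii) $(\exists f)(\forall m,n,r)(f(m,n,r)=g(m))$; (iii) $(\exists f)(\forall m,n)(f(m,n)=g(m,n,r))$; (iv) $(\exists f)(\forall m)(f(m)=g(m,n,r))$; (v) $(\exists f)(\forall m,n,r)(f(m,n,r)=g(h_1(m,n,r),h_2(m,n,r),h_3(m,n,r)))$. (6) Rudimentary induction: for unary $f,g$: $f(0)=g(0)\wedge(\forall n)(f(n)=g(n)\rightarrow f(S(n))=g(S(n)))\rightarrow f(n)=g(n)$.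 $PRA$ (primitive recursion axiom): for unary $g$ and ternary $h$, $(\exists f)(\forall m)(f(m,0)=g(m)\wedge(\forall n)(f(m,S(n))=h(m,n,f(m,n))))$, $f$ binary. $WPRA$ (weakened primitive recursion axiom): for unary $g$ and ternary $h$, $(\exists f)(\forall m)(f(m,0)=g(m)\wedge(\forall n)(f(m,S(n))=h(m,S(n),f(m,n))))$, $f$ binary. -}

module Defs where

open import Data.Product using (Σ; _×_)
open import Relation.Binary.PropositionalEquality using (_≡_; _≢_)

-- A (Henkin) structure for the four-sorted language L_fcn:
-- a number domain with 0 and S, and three function domains (arities 1,2,3)
-- with application maps.
record Structure : Set₁ where
  field
    N   : Set
    F1  : Set
    F2  : Set
    F3  : Set
    z   : N
    S   : N → N
    ap1 : F1 → N → N
    ap2 : F2 → N → N → N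
    ap3 : F3 → N → N → N → N

record COMI (M : Structure) : Set where
  open Structure M
  field
    succ-ne-zero : ∀ n → S n ≢ z
    succ-inj     : ∀ n m → S n ≡ S m → n ≡ m
    succ-pred    : ∀ n → n ≢ z → Σ N (λ m → S m ≡ n)
    const   : ∀ n → Σ F1 (λ f → ∀ m → ap1 f m ≡ n)
    proj1   : Σ F3 (λ f → ∀ m n r → ap3 f m n r ≡ m)
    proj2   : Σ F3 (λ f → ∀ m n r → ap3 f m n r ≡ n)
    proj3   : Σ F3 (λ f → ∀ m n r → ap3 f m n r ≡ r)
    succ    : Σ F1 (λ f → ∀ n → ap1 f n ≡ S n)
    comp-i   : ∀ (g : F2) → Σ F3 (λ f → ∀ m n r → ap3 f m n r ≡ ap2 g m n)
    comp-ii  : ∀ (g : F1) → Σ F3 (λ f → ∀ m n r → ap3 f m n r ≡ ap1 g m)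
    comp-iii : ∀ (g : F3) (r : N) → Σ F2 (λ f → ∀ m n → ap2 f m n ≡ ap3 g m n r)
    comp-iv  : ∀ (g : F3) (n r : N) → Σ F1 (λ f → ∀ m → ap1 f m ≡ ap3 g m n r)
    comp-v   : ∀ (g h₁ h₂ h₃ : F3) →
               Σ F3 (λ f → ∀ m n r →
                 ap3 f m n r ≡ ap3 g (ap3 h₁ m n r) (ap3 h₂ m n r) (ap3 h₃ m n r))
    rud-ind  : ∀ (f g : F1) (n : N) →
               ap1 f z ≡ ap1 g z →
               (∀ k → ap1 f k ≡ ap1 g k → ap1 f (S k) ≡ ap1 g (S k)) →
               ap1 f n ≡ ap1 g n

PRA : Structure → Set
PRA M = ∀ (g : F1) (h : F3) →
  Σ F2 (λ f → ∀ m → (ap2 f m z ≡ ap1 g m) ×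
                     (∀ n → ap2 f m (S n) ≡ ap3 h m n (ap2 f m n)))
  where open Structure M

WPRA : Structure → Set
WPRA M = ∀ (g : F1) (h : F3) →
  Σ F2 (λ f → ∀ m → (ap2 f m z ≡ ap1 g m) ×
                     (∀ n → ap2 f m (S n) ≡ ap3 h m (S n) (ap2 f m n)))
  where open Structure M

{-# OPTIONS --safe #-}
-- PRA ⇒ WPRA: recurse with the step function h(m, S n, r) instead of h.
-- WPRA ⇒ PRA: once the predecessor is available as an element of F2,
-- recursing with h(m, pred n, r) under WPRA gives PRA.  The predecessor itself
-- comes from WPRA through pred (S n) = sucOr (isEven (S n)) (pred n), where
-- sucOr a 0 = a and sucOr a (S k) = S (S k): the step only fails to be S (pred n)
-- when pred n = 0, i.e. for n ∈ {0, 1}, and these two cases are told apart by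
-- the parity of S n, which WPRA defines by iterating the zero test.
module Submission where

open import Defs
open import Data.Product using (_×_; Σ; _,_)
open import Relation.Binary.PropositionalEquality
open ≡-Reasoning

module _ {M : Structure} (C : COMI M) where
  open Structure M
  open COMI C

  Definable₁ : (N → N) → Set
  Definable₁ φ = Σ F1 (λ f → ∀ m → ap1 f m ≡ φ m)

  Definable₃ : (N → N → N → N) → Set
  Definable₃ φ = Σ F3 (λ f → ∀ m n r → ap3 f m n r ≡ φ m n r)

  def-π₁ : Definable₃ (λ m n r → m)
  def-π₁ = proj1

  def-π₂ : Definable₃ (λ m n r → n)
  def-π₂ = proj2

  def-π₃ : Definable₃ (λ m n r → r)
  def-π₃ = proj3

  def-ap3 : (g : F3) {φ₁ φ₂ φ₃ : N → N → N → N} →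
            Definable₃ φ₁ → Definable₃ φ₂ → Definable₃ φ₃ →
            Definable₃ (λ m n r → ap3 g (φ₁ m n r) (φ₂ m n r) (φ₃ m n r))
  def-ap3 g (f₁ , e₁) (f₂ , e₂) (f₃ , e₃) with comp-v g f₁ f₂ f₃
  ... | f , e = f , λ m n r → trans (e m n r) (cong₃ (e₁ m n r) (e₂ m n r) (e₃ m n r))
    where
    cong₃ : ∀ {a a′ b b′ c c′} → a ≡ a′ → b ≡ b′ → c ≡ c′ → ap3 g a b c ≡ ap3 g a′ b′ c′
    cong₃ refl refl refl = refl

  def-ap2 : (g : F2) {φ₁ φ₂ : N → N → N → N} → Definable₃ φ₁ → Definable₃ φ₂ →
            Definable₃ (λ m n r → ap2 g (φ₁ m n r) (φ₂ m n r))
  def-ap2 g d₁ d₂ with comp-i g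
  ... | g₃ , e₃ with def-ap3 g₃ d₁ d₂ d₁
  ...   | f , e = f , λ m n r → trans (e m n r) (e₃ _ _ _)

  def-ap1 : (g : F1) {φ : N → N → N → N} → Definable₃ φ →
            Definable₃ (λ m n r → ap1 g (φ m n r))
  def-ap1 g d with comp-ii g
  ... | g₃ , e₃ with def-ap3 g₃ d d d
  ...   | f , e = f , λ m n r → trans (e m n r) (e₃ _ _ _)

  def-const : (c : N) → Definable₃ (λ m n r → c)
  def-const c with const c
  ... | k , eₖ with def-ap1 k def-π₁
  ...   | f , e = f , λ m n r → trans (e m n r) (eₖ _)

  def-S : {φ : N → N → N → N} → Definable₃ φ → Definable₃ (λ m n r → S (φ m n r))
  def-S d with succ
  ... | s , eₛ with def-ap1 s d
  ...   | f , e = f , λ m n r → trans (e m n r) (eₛ _)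

  def-fix₂₃ : {φ : N → N → N → N} → Definable₃ φ → ∀ n r → Definable₁ (λ m → φ m n r)
  def-fix₂₃ (f , e) n r with comp-iv f n r
  ... | g , e′ = g , λ m → trans (e′ m) (e m n r)

  def-unary : {φ : N → N} → Definable₃ (λ m n r → φ m) → Definable₁ φ
  def-unary d = def-fix₂₃ d z z

  definable-induction : {φ ψ : N → N} → Definable₁ φ → Definable₁ ψ →
                        φ z ≡ ψ z → (∀ k → φ k ≡ ψ k → φ (S k) ≡ ψ (S k)) →
                        ∀ n → φ n ≡ ψ n
  definable-induction (f , e) (g , e′) base step n =
    trans (sym (e n)) (trans (rud-ind f g n base′ step′) (e′ n))
    where
    base′ : ap1 f z ≡ ap1 g z
    base′ = trans (e z) (trans base (sym (e′ z)))
    step′ : ∀ k → ap1 f k ≡ ap1 g k → ap1 f (S k) ≡ ap1 g (S k)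
    step′ k eq = trans (e (S k)) (trans (step k (trans (sym (e k)) (trans eq (e′ k))))
                                        (sym (e′ (S k))))

  pra⇒wpra : PRA M → WPRA M
  pra⇒wpra pra g h with def-ap3 h def-π₁ (def-S def-π₂) def-π₃
  ... | h′ , e′ with pra g h′
  ...   | f , e = f , λ m → let (f-zero , f-suc) = e m in
                            f-zero , λ n → trans (f-suc n) (e′ m n (ap2 f m n))

  record WRecursive (γ : N → N) (η : N → N → N → N) : Set where
    field
      fun      : F2
      fun-zero : ∀ m → ap2 fun m z ≡ γ m
      fun-suc  : ∀ m n → ap2 fun m (S n) ≡ η m (S n) (ap2 fun m n)

  module _ (wpra : WPRA M) where

    wrecursive : {γ : N → N} {η : N → N → N → N} →
                 Definable₁ γ → Definable₃ η → WRecursive γ η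
    wrecursive (g , e₁) (h , e₃) with wpra g h
    ... | f , e = record
      { fun      = f
      ; fun-zero = λ m → let (f-zero , _) = e m in trans f-zero (e₁ m)
      ; fun-suc  = λ m n → let (_ , f-suc) = e m in trans (f-suc n) (e₃ m (S n) (ap2 f m n))
      }

    open WRecursive (wrecursive (def-unary (def-const (S z))) (def-const z))
      renaming (fun to isZero; fun-zero to isZero-zero; fun-suc to isZero-suc)

    open WRecursive (wrecursive (def-unary (def-const (S z))) (def-ap2 isZero def-π₁ def-π₃))
      renaming (fun to isEven; fun-zero to isEven-zero; fun-suc to isEven-suc)

    open WRecursive (wrecursive (def-unary def-π₁) (def-S def-π₂))
      renaming (fun to sucOr; fun-zero to sucOr-zero; fun-suc to sucOr-suc)

    open WRecursive (wrecursive (def-unary (def-const z))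
                                (def-ap2 sucOr (def-ap2 isEven def-π₁ def-π₂) def-π₃))
      renaming (fun to pred; fun-zero to pred-zero; fun-suc to pred-suc-step)

    isEven-one : ∀ m → ap2 isEven m (S z) ≡ z
    isEven-one m = begin
      ap2 isEven m (S z)               ≡⟨ isEven-suc m z ⟩
      ap2 isZero m (ap2 isEven m z)    ≡⟨ cong (ap2 isZero m) (isEven-zero m) ⟩
      ap2 isZero m (S z)               ≡⟨ isZero-suc m z ⟩
      z                                ∎

    isEven-two : ∀ m → ap2 isEven m (S (S z)) ≡ S z
    isEven-two m = begin
      ap2 isEven m (S (S z))           ≡⟨ isEven-suc m (S z) ⟩
      ap2 isZero m (ap2 isEven m (S z)) ≡⟨ cong (ap2 isZero m) (isEven-one m) ⟩
      ap2 isZero m z                   ≡⟨ isZero-zero m ⟩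
      S z                              ∎

    -- Induction serves only as a zero/successor case split here.
    sucOr-isEven : ∀ m k → ap2 sucOr (ap2 isEven m (S (S k))) k ≡ S k
    sucOr-isEven m = definable-induction
      (def-unary (def-ap2 sucOr (def-ap2 isEven (def-const m) (def-S (def-S def-π₁))) def-π₁))
      (def-unary (def-S def-π₁))
      (trans (sucOr-zero _) (isEven-two m))
      (λ k _ → sucOr-suc _ k)

    pred-suc : ∀ m n → ap2 pred m (S n) ≡ n
    pred-suc m = definable-induction
      (def-unary (def-ap2 pred (def-const m) (def-S def-π₁)))
      (def-unary def-π₁)
      (begin
        ap2 pred m (S z)                                  ≡⟨ pred-suc-step m z ⟩
        ap2 sucOr (ap2 isEven m (S z)) (ap2 pred m z)     ≡⟨ cong (ap2 sucOr _) (pred-zero m) ⟩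
        ap2 sucOr (ap2 isEven m (S z)) z                  ≡⟨ sucOr-zero _ ⟩
        ap2 isEven m (S z)                                ≡⟨ isEven-one m ⟩
        z                                                 ∎)
      (λ k ih → begin
        ap2 pred m (S (S k))                                   ≡⟨ pred-suc-step m (S k) ⟩
        ap2 sucOr (ap2 isEven m (S (S k))) (ap2 pred m (S k))  ≡⟨ cong (ap2 sucOr _) ih ⟩
        ap2 sucOr (ap2 isEven m (S (S k))) k                   ≡⟨ sucOr-isEven m k ⟩
        S k                                                    ∎)

    wpra⇒pra : PRA M
    wpra⇒pra g h with def-ap3 h def-π₁ (def-ap2 pred def-π₁ def-π₂) def-π₃
    ... | h′ , e′ with wpra g h′
    ...   | f , e = f , λ m → let (f-zero , f-suc) = e m in
                              f-zero , λ n → begin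
        ap2 f m (S n)                                ≡⟨ f-suc n ⟩
        ap3 h′ m (S n) (ap2 f m n)                   ≡⟨ e′ m (S n) (ap2 f m n) ⟩
        ap3 h m (ap2 pred m (S n)) (ap2 f m n)       ≡⟨ cong (λ a → ap3 h m a (ap2 f m n)) (pred-suc m n) ⟩
        ap3 h m n (ap2 f m n)                        ∎

corollary1 : ((M : Structure) → COMI M → PRA M → WPRA M)
           × ((M : Structure) → COMI M → WPRA M → PRA M)
corollary1 = (λ M → pra⇒wpra) , (λ M → wpra⇒pra)
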